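{- Let $\phi$ be a set of UTVPI constraints that is satisfiable (over the integers), and let $c$ be a UTVPI constraint of one of the forms $x-y\le d$, $x+y\le d$, $-x-y\le d$, $x\le d$, $-x\le d$. Then $\phi\models c$ if and only if for every edge $(u,v,e)\in E(c)$ (edge from $u$ to $v$ of weight $e$), either $wSP(u,v)\le e$ or $\rho(u)+\rho(-v)\le e$, where $wSP$ and $\rho$ are computed in $G_\phi$.
   Context: Variables range over $\mathbb{Z}$, and $\phi\models c$ means every integer solution of $\phi$ satisfies $c$. For a UTVPI constraint $c$, the edge set $E(c)$ over vertices $x^+,x^-$ (one pair per variable) is: - $x-y\le d$: $\{y^+\xrightarrow{d}x^+,\ x^-\xrightarrow{d}y^-\}$; - $x+y\le d$: $\{y^-\xrightarrow{d}x^+,\ x^-\xrightarrow{d}y^+\}$; - $-x-y\le d$: $\{y^+\xrightarrow{d}x^-,\ x^+\xrightarrow{d}y^-\}$; - $x\le d$: $\{x^-\xrightarrow{2d}x^+\}$; - $-x\le d$: $\{x^+\xrightarrow{2d}x^-\}$. The constraint graph $G_\phi$ has vertices $x^\pm$ for the variables and edge set $\bigcup_{c\in\phi}E(c)$. Write $-x^+:=x^-$ and $-x^-:=x^+$. For a graph without negative weight cycles, $wSP(u,v)$ is the minimum weight of a path from $u$ to $v$, or $+\infty$ if none exists. The bounds function is $\rho(u)=\lfloor wSP(u,-u)/2\rfloor$. -}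

module Defs where

open import Data.Nat using (ℕ)
open import Data.Fin using (Fin)
open import Data.Bool using (Bool; true; false; not)
open import Data.Integer using (ℤ; +_; _+_; _-_; -_; _*_; _≤_; 0ℤ)
open import Data.Integer.DivMod using (_/ℕ_)
open import Data.List using (List; []; _∷_; concatMap)
open import Data.List.Relation.Unary.All using (All)
open import Data.List.Membership.Propositional using (_∈_)
open import Data.Maybe using (Maybe; just; nothing)
open import Data.Product using (_×_; _,_; ∃; Σ)
open import Data.Empty using (⊥)
open import Relation.Nullary using (¬_)

data UTVPI (n : ℕ) : Set where
  diff   : Fin n → Fin n → ℤ → UTVPI n
  plus   : Fin n → Fin n → ℤ → UTVPI n
  minus  : Fin n → Fin n → ℤ → UTVPI n
  upper  : Fin n → ℤ → UTVPI n
  lower  : Fin n → ℤ → UTVPI n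

Assignment : ℕ → Set
Assignment n = Fin n → ℤ

Sat : ∀ {n} → Assignment n → UTVPI n → Set
Sat σ (diff x y d)  = σ x - σ y ≤ d
Sat σ (plus x y d)  = σ x + σ y ≤ d
Sat σ (minus x y d) = - σ x - σ y ≤ d
Sat σ (upper x d)   = σ x ≤ d
Sat σ (lower x d)   = - σ x ≤ d

System : ℕ → Set
System n = List (UTVPI n)

Satisfiable : ∀ {n} → System n → Set
Satisfiable {n} φ = ∃ λ (σ : Assignment n) → All (Sat σ) φ

_⊨_ : ∀ {n} → System n → UTVPI n → Set
_⊨_ {n} φ c = (σ : Assignment n) → All (Sat σ) φ → Sat σ c

-- vertex (x , true) is x⁺, (x , false) is x⁻
Vertex : ℕ → Set
Vertex n = Fin n × Bool

pos neg : ∀ {n} → Fin n → Vertex n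
pos x = x , true
neg x = x , false

op : ∀ {n} → Vertex n → Vertex n
op (x , b) = x , not b

record Edge (n : ℕ) : Set where
  constructor edge
  field
    src : Vertex n
    tgt : Vertex n
    wt  : ℤ

E : ∀ {n} → UTVPI n → List (Edge n)
E (diff x y d)  = edge (pos y) (pos x) d ∷ edge (neg x) (neg y) d ∷ []
E (plus x y d)  = edge (neg y) (pos x) d ∷ edge (neg x) (pos y) d ∷ []
E (minus x y d) = edge (pos y) (neg x) d ∷ edge (pos x) (neg y) d ∷ []
E (upper x d)   = edge (neg x) (pos x) (+ 2 * d) ∷ []
E (lower x d)   = edge (pos x) (neg x) (+ 2 * d) ∷ []

Graph : ℕ → Set
Graph n = List (Edge n)

G : ∀ {n} → System n → Graph n
G φ = concatMap E φ

data Path {n} (g : Graph n) : Vertex n → Vertex n → ℤ → Set where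
  []  : ∀ {u} → Path g u u 0ℤ
  _∷_ : ∀ {u v t d w} → edge u v d ∈ g → Path g v t w → Path g u t (d + w)

-- Extended integers ℤ ∪ {+∞}; nothing = +∞

ℤ∞ : Set
ℤ∞ = Maybe ℤ

_≤∞_ : ℤ∞ → ℤ → Set
just a  ≤∞ e = a ≤ e
nothing ≤∞ e = ⊥

_+∞_ : ℤ∞ → ℤ∞ → ℤ∞
just a +∞ just b = just (a + b)
_      +∞ _      = nothing

-- ⌊ a / 2 ⌋, with ⌊ ∞ / 2 ⌋ = ∞
half∞ : ℤ∞ → ℤ∞
half∞ (just a) = just (a /ℕ 2)
half∞ nothing  = nothing

IsWSP : ∀ {n} → Graph n → Vertex n → Vertex n → ℤ∞ → Set
IsWSP g u v nothing  = ∀ w → ¬ Path g u v w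
IsWSP g u v (just m) = Path g u v m × (∀ w → Path g u v w → m ≤ w)

IsWSPFun : ∀ {n} → Graph n → (Vertex n → Vertex n → ℤ∞) → Set
IsWSPFun g wSP = ∀ u v → IsWSP g u v (wSP u v)

ρ : ∀ {n} → (Vertex n → Vertex n → ℤ∞) → Vertex n → ℤ∞
ρ wSP u = half∞ (wSP u (op u))

-- An assignment σ gives every vertex a value (x⁺ ↦ σ x, x⁻ ↦ -σ x), and σ satisfies a
-- constraint c exactly when every edge u -d-> v of E(c) obeys val v - val u ≤ d.  So a
-- solution of φ is a "feasible potential" of G_φ, which bounds every path weight from below.
--
-- Soundness (⇐): along any path the potential difference is at most the path weight, so
-- wSP(u,v) ≤ e bounds val v - val u directly; a path u -> -u bounds 2·val(-u), hence
-- ρ(u) ≥ val(-u) by rounding down, and ρ(u) + ρ(-v) ≤ e bounds val(-u) + val v.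
--
-- Completeness (⇒): if both conditions fail for an edge u -e-> v of E(c), we start from a
-- solution and repeatedly build a solution with strictly larger val v - val u until it
-- exceeds e, contradicting φ ⊨ c.  One step pivots on a vertex p with no path -p -> p of
-- slack ≤ 1 (p = v, or p = -u after mirroring): it shifts every vertex with a tight path to
-- p by +1 and every vertex with a tight path from -p by -1; integrality and the mirror
-- symmetry of G_φ keep the shifted potential feasible.  If neither pivot exists, both
-- cycles have slack ≤ 1 and then ρ(u) + ρ(-v) ≤ val v - val u.

module Submission where

open import Defs
open import Data.Nat using (ℕ; zero; suc; z≤n)
open import Data.Nat.Properties using (n<1+n)
open import Data.Bool using (true; false)
open import Data.Integer
  using (ℤ; +_; -[1+_]; _+_; _-_; -_; _*_; _≤_; _<_; 0ℤ; 1ℤ; ∣_∣; _≤?_; +≤+; +<+; -≤+)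
open import Data.Integer.Properties
  using ( ≤-refl; ≤-trans; ≤-reflexive; ≰⇒>; <-≤-trans; ≤-<-trans; <-irrefl
        ; +-mono-≤; +-monoʳ-≤; +-monoˡ-≤; +-monoʳ-<; neg-mono-≤; i<j⇒suc[i]≤j; suc[i]≤j⇒i<j
        ; pred-mono; pred-suc; *-cancelʳ-<-nonNeg; *-cancelˡ-≤-pos; *-monoˡ-≤-nonNeg
        ; *-comm; +-identityˡ; +-identityʳ; +-assoc; +-comm; +-inverseʳ; neg-involutive; neg-distrib-+
        ; module ≤-Reasoning )
open import Data.Integer.DivMod using (_/ℕ_; [n/ℕd]*d≤n; n<s[n/ℕd]*d)
open import Data.Integer.Tactic.RingSolver using (solve-∀)
open import Data.List.Relation.Unary.Any using (here; there)
import Data.List.Relation.Unary.Any as Any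
import Data.List.Relation.Unary.All as All
open import Data.List.Membership.Propositional using (_∈_; find; lose)
open import Data.List.Membership.Propositional.Properties using (∈-concatMap⁺; ∈-concatMap⁻)
open import Data.Maybe using (just; nothing)
open import Data.Product using (Σ; _×_; _,_)
open import Data.Sum using (_⊎_; inj₁; inj₂)
open import Data.Unit using (⊤; tt)
open import Data.Empty using (⊥-elim)
open import Relation.Nullary using (¬_; Dec; yes; no)
open import Relation.Binary.PropositionalEquality
  using (_≡_; refl; sym; trans; cong; cong₂; subst; subst₂; module ≡-Reasoning)
open import Function.Bundles using (_⇔_; mk⇔; Equivalence)

<-suc⇒≤ : ∀ {i j} → i < 1ℤ + j → i ≤ j
<-suc⇒≤ {i} {j} lt = subst₂ _≤_ (pred-suc i) (pred-suc j) (pred-mono (i<j⇒suc[i]≤j lt))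

half-greatest : ∀ m k → + 2 * k ≤ m → k ≤ m /ℕ 2
half-greatest m k 2k≤m = <-suc⇒≤ (*-cancelʳ-<-nonNeg (+ 2) k*2<)
  where
  k*2< : k * + 2 < (1ℤ + m /ℕ 2) * + 2
  k*2< = ≤-<-trans (≤-reflexive (*-comm k (+ 2))) (≤-<-trans 2k≤m (n<s[n/ℕd]*d m 2))

half-least : ∀ m k → m ≤ + 2 * k + 1ℤ → m /ℕ 2 ≤ k
half-least m k m≤2k+1 = <-suc⇒≤ (*-cancelʳ-<-nonNeg (+ 2) q*2<)
  where
  double-suc : ∀ k → 1ℤ + (+ 2 * k + 1ℤ) ≡ (1ℤ + k) * + 2
  double-suc = solve-∀
  q*2< : (m /ℕ 2) * + 2 < (1ℤ + k) * + 2
  q*2< = ≤-<-trans ([n/ℕd]*d≤n m 2)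
           (≤-<-trans m≤2k+1 (suc[i]≤j⇒i<j (≤-reflexive (double-suc k))))

i≤∣i∣ : ∀ i → i ≤ + ∣ i ∣
i≤∣i∣ (+ n)    = ≤-refl
i≤∣i∣ -[1+ n ] = -≤+

-- i lies strictly below j + (1 + |i - j|); used as a termination budget.
below-budget : ∀ i j → i < j + + suc ∣ i - j ∣
below-budget i j = ≤-<-trans i≤ (+-monoʳ-< j (+<+ (n<1+n ∣ i - j ∣)))
  where
  split : ∀ i j → i ≡ j + (i - j)
  split = solve-∀
  i≤ : i ≤ j + + ∣ i - j ∣
  i≤ = ≤-trans (≤-reflexive (split i j)) (+-monoʳ-≤ j (i≤∣i∣ (i - j)))

-- i ≼ x : the integer i is a lower bound of x ∈ ℤ ∪ {+∞} (always true for x = +∞).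
-- Lower bounds come from feasible potentials, upper bounds (≤∞) from the conditions.
infix 4 _≼_ _≤∞?_
_≼_ : ℤ → ℤ∞ → Set
i ≼ just a  = i ≤ a
i ≼ nothing = ⊤

≼-≤∞ : ∀ {i e} (x : ℤ∞) → i ≼ x → x ≤∞ e → i ≤ e
≼-≤∞ (just a) i≤a a≤e = ≤-trans i≤a a≤e

≼-+∞ : ∀ {i j} (x y : ℤ∞) → i ≼ x → j ≼ y → (i + j) ≼ (x +∞ y)
≼-+∞ (just a) (just b) i≤a j≤b = +-mono-≤ i≤a j≤b
≼-+∞ (just a) nothing  _   _   = tt
≼-+∞ nothing  _        _   _   = tt

≤∞-trans : ∀ {i j} (x : ℤ∞) → x ≤∞ i → i ≤ j → x ≤∞ j
≤∞-trans (just a) a≤i i≤j = ≤-trans a≤i i≤j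

+∞-mono : ∀ {i j} (x y : ℤ∞) → x ≤∞ i → y ≤∞ j → (x +∞ y) ≤∞ (i + j)
+∞-mono (just a) (just b) a≤i b≤j = +-mono-≤ a≤i b≤j

_≤∞?_ : ∀ (x : ℤ∞) e → Dec (x ≤∞ e)
just a  ≤∞? e = a ≤? e
nothing ≤∞? e = no λ ()

half∞-≼ : ∀ {k} (x : ℤ∞) → + 2 * k ≼ x → k ≼ half∞ x
half∞-≼ (just m) 2k≤m = half-greatest m _ 2k≤m
half∞-≼ nothing  _    = tt

half∞-≤∞ : ∀ {k} (x : ℤ∞) → x ≤∞ (+ 2 * k + 1ℤ) → half∞ x ≤∞ k
half∞-≤∞ (just m) m≤ = half-least m _ m≤

module _ {n : ℕ} where

  val : Assignment n → Vertex n → ℤ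
  val σ (x , true)  = σ x
  val σ (x , false) = - σ x

  gap : Assignment n → Vertex n → Vertex n → ℤ
  gap σ u v = val σ v - val σ u

  op-involutive : (a : Vertex n) → op (op a) ≡ a
  op-involutive (x , true)  = refl
  op-involutive (x , false) = refl

  val-op : ∀ σ (a : Vertex n) → val σ (op a) ≡ - val σ a
  val-op σ (x , true)  = refl
  val-op σ (x , false) = sym (neg-involutive (σ x))

  gap-refl : ∀ σ (a : Vertex n) → gap σ a a ≡ 0ℤ
  gap-refl σ a = +-inverseʳ (val σ a)

  gap-trans : ∀ σ (a b c : Vertex n) → gap σ a c ≡ gap σ a b + gap σ b c
  gap-trans σ a b c = telescope (val σ a) (val σ b) (val σ c)
    where
    telescope : ∀ x y z → z - x ≡ (y - x) + (z - y)
    telescope = solve-∀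

  gap-mirror : ∀ σ (a b : Vertex n) → gap σ (op b) (op a) ≡ gap σ a b
  gap-mirror σ a b = begin
    val σ (op a) - val σ (op b) ≡⟨ cong₂ _-_ (val-op σ a) (val-op σ b) ⟩
    - val σ a - - val σ b       ≡⟨ swap (val σ a) (val σ b) ⟩
    val σ b - val σ a           ∎
    where
    open ≡-Reasoning
    swap : ∀ x y → - x - - y ≡ y - x
    swap = solve-∀

  gap-op : ∀ σ (a : Vertex n) → gap σ a (op a) ≡ + 2 * val σ (op a)
  gap-op σ (x , true)  = double (σ x)
    where
    double : ∀ y → - y - y ≡ + 2 * (- y)
    double = solve-∀
  gap-op σ (x , false) = double (σ x)
    where
    double : ∀ y → y - - y ≡ + 2 * y
    double = solve-∀

  -- val v - val u split into the two halves bounded by ρ(u) and ρ(-v)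
  gap-halves : ∀ σ (u v : Vertex n) → gap σ u v ≡ val σ (op u) + val σ (op (op v))
  gap-halves σ u v = begin
    val σ v - val σ u                ≡⟨ +-comm (val σ v) (- val σ u) ⟩
    - val σ u + val σ v              ≡⟨ cong₂ _+_ (sym (val-op σ u))
                                                  (cong (val σ) (sym (op-involutive v))) ⟩
    val σ (op u) + val σ (op (op v)) ∎
    where open ≡-Reasoning

Feasible : ∀ {n} → Graph n → Assignment n → Set
Feasible g σ = ∀ {u v d} → edge u v d ∈ g → gap σ u v ≤ d

MirrorClosed : ∀ {n} → Graph n → Set
MirrorClosed g = ∀ {u v d} → edge u v d ∈ g → edge (op v) (op u) d ∈ g

module _ {n : ℕ} where

  -- the two edges of each E(c) are mirror images, hence so are the edges of G_φ
  E-mirror : (c : UTVPI n) → MirrorClosed (E c)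
  E-mirror (diff x y d)  (here refl)         = there (here refl)
  E-mirror (diff x y d)  (there (here refl)) = here refl
  E-mirror (plus x y d)  (here refl)         = there (here refl)
  E-mirror (plus x y d)  (there (here refl)) = here refl
  E-mirror (minus x y d) (here refl)         = there (here refl)
  E-mirror (minus x y d) (there (here refl)) = here refl
  E-mirror (upper x d)   (here refl)         = here refl
  E-mirror (lower x d)   (here refl)         = here refl

  G-mirror : (φ : System n) → MirrorClosed (G φ)
  G-mirror φ m =
    ∈-concatMap⁺ E {xs = φ} (Any.map (λ {c} → E-mirror c) (∈-concatMap⁻ E {xs = φ} m))

  -- σ satisfies c iff σ respects every edge of E(c); the two edges of a binary
  -- constraint are mirror images, so the first one already carries the constraint.
  sat⇔feasible : ∀ σ (c : UTVPI n) → Sat σ c ⇔ Feasible (E c) σ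
  sat⇔feasible σ c = mk⇔ (to c) (from c)
    where
    neg-sub : ∀ a b → - b - - a ≡ a - b
    neg-sub = solve-∀
    sub-neg : ∀ a b → a - - b ≡ a + b
    sub-neg = solve-∀
    sub-neg′ : ∀ a b → b - - a ≡ a + b
    sub-neg′ = solve-∀
    neg-sub-comm : ∀ a b → - b - a ≡ - a - b
    neg-sub-comm = solve-∀

    to : ∀ c → Sat σ c → Feasible (E c) σ
    to (diff x y d)  s (here refl)         = s
    to (diff x y d)  s (there (here refl)) = subst (_≤ d) (sym (neg-sub (σ x) (σ y))) s
    to (plus x y d)  s (here refl)         = subst (_≤ d) (sym (sub-neg (σ x) (σ y))) s
    to (plus x y d)  s (there (here refl)) = subst (_≤ d) (sym (sub-neg′ (σ x) (σ y))) s
    to (minus x y d) s (here refl)         = s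
    to (minus x y d) s (there (here refl)) = subst (_≤ d) (sym (neg-sub-comm (σ x) (σ y))) s
    to (upper x d)   s (here refl)         =
      subst (_≤ + 2 * d) (sym (gap-op σ (x , false))) (*-monoˡ-≤-nonNeg (+ 2) s)
    to (lower x d)   s (here refl)         =
      subst (_≤ + 2 * d) (sym (gap-op σ (x , true))) (*-monoˡ-≤-nonNeg (+ 2) s)

    from : ∀ c → Feasible (E c) σ → Sat σ c
    from (diff x y d)  fe = fe (here refl)
    from (plus x y d)  fe = subst (_≤ d) (sub-neg (σ x) (σ y)) (fe (here refl))
    from (minus x y d) fe = fe (here refl)
    from (upper x d)   fe =
      *-cancelˡ-≤-pos (σ x) d (+ 2) (subst (_≤ + 2 * d) (gap-op σ (x , false)) (fe (here refl)))
    from (lower x d)   fe =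
      *-cancelˡ-≤-pos (- σ x) d (+ 2) (subst (_≤ + 2 * d) (gap-op σ (x , true)) (fe (here refl)))

  solution⇔feasible : ∀ σ (φ : System n) → All.All (Sat σ) φ ⇔ Feasible (G φ) σ
  solution⇔feasible σ φ = mk⇔ to from
    where
    to : All.All (Sat σ) φ → Feasible (G φ) σ
    to sat m with find (∈-concatMap⁻ E {xs = φ} m)
    ... | c , c∈φ , m∈Ec = Equivalence.to (sat⇔feasible σ c) (All.lookup sat c∈φ) m∈Ec

    from : Feasible (G φ) σ → All.All (Sat σ) φ
    from fe = All.tabulate λ {c} c∈φ →
      Equivalence.from (sat⇔feasible σ c) λ m∈Ec → fe (∈-concatMap⁺ E {xs = φ} (lose c∈φ m∈Ec))

-- From here on g is any mirror-closed graph with shortest-path function W; feasible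
-- potentials of g play the role of solutions of φ.

module Potentials {n : ℕ} (g : Graph n) (mirror-closed : MirrorClosed g)
                  (W : Vertex n → Vertex n → ℤ∞) (W-spec : IsWSPFun g W) where

  _++ᵖ_ : ∀ {a b c w w′} → Path g a b w → Path g b c w′ → Path g a c (w + w′)
  _++ᵖ_ {w′ = w′} [] q = subst (Path g _ _) (sym (+-identityˡ w′)) q
  _++ᵖ_ {w′ = w′} (_∷_ {d = d} {w = w} e p) q =
    subst (Path g _ _) (sym (+-assoc d w w′)) (e ∷ (p ++ᵖ q))

  mirror : ∀ {a b w} → Path g a b w → Path g (op b) (op a) w
  mirror [] = []
  mirror (_∷_ {d = d} {w = w} e p) =
    subst (Path g _ _) reorder (mirror p ++ᵖ (mirror-closed e ∷ []))
    where
    reorder : w + (d + 0ℤ) ≡ d + w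
    reorder = trans (cong (λ z → w + z) (+-identityʳ d)) (+-comm w d)

  path-bound : ∀ {σ} → Feasible g σ → ∀ {a b w} → Path g a b w → gap σ a b ≤ w
  path-bound {σ} fe {a} [] = ≤-reflexive (gap-refl σ a)
  path-bound {σ} fe {a} {b} (_∷_ {v = v} e p) =
    subst (_≤ _) (sym (gap-trans σ a v b)) (+-mono-≤ (fe e) (path-bound fe p))

  shortest-below : ∀ {a b w} → Path g a b w → W a b ≤∞ w
  shortest-below {a} {b} {w} p with W a b | W-spec a b
  ... | nothing | none       = ⊥-elim (none w p)
  ... | just m  | (_ , least) = least w p

  wSP-lower : ∀ {σ} → Feasible g σ → ∀ a b → gap σ a b ≼ W a b
  wSP-lower fe a b with W a b | W-spec a b
  ... | nothing | _       = tt
  ... | just m  | (p , _) = path-bound fe p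

  ρ-lower : ∀ {σ} → Feasible g σ → ∀ a → val σ (op a) ≼ ρ W a
  ρ-lower {σ} fe a =
    half∞-≼ (W a (op a)) (subst (_≼ W a (op a)) (gap-op σ a) (wSP-lower fe a (op a)))

  ρ-sum-lower : ∀ {σ} → Feasible g σ → ∀ u v → gap σ u v ≼ (ρ W u +∞ ρ W (op v))
  ρ-sum-lower {σ} fe u v =
    subst (_≼ _) (sym (gap-halves σ u v))
      (≼-+∞ (ρ W u) (ρ W (op v)) (ρ-lower fe u) (ρ-lower fe (op v)))

  Tight : Assignment n → Vertex n → Vertex n → ℤ → Set
  Tight σ a b k = Σ ℤ λ w → Path g a b w × w ≤ gap σ a b + k

  tight? : ∀ σ a b k → Dec (Tight σ a b k)
  tight? σ a b k with W a b | W-spec a b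
  ... | nothing | none = no λ (w , p , _) → none w p
  ... | just m  | (p , least) with m ≤? gap σ a b + k
  ...   | yes m≤ = yes (m , p , m≤)
  ...   | no m≰  = no λ (w , q , w≤) → m≰ (≤-trans (least w q) w≤)

  tight-refl : ∀ σ a → Tight σ a a 0ℤ
  tight-refl σ a = 0ℤ , [] , ≤-reflexive (sym (trans (+-identityʳ _) (gap-refl σ a)))

  tight-trans : ∀ {σ a b c k m} → Tight σ a b k → Tight σ b c m → Tight σ a c (k + m)
  tight-trans {σ} {a} {b} {c} {k} {m} (w₁ , p₁ , w₁≤) (w₂ , p₂ , w₂≤) =
    w₁ + w₂ , p₁ ++ᵖ p₂ , ≤-trans (+-mono-≤ w₁≤ w₂≤) (≤-reflexive regroup)
    where
    interchange : ∀ x y k m → (x + k) + (y + m) ≡ (x + y) + (k + m)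
    interchange = solve-∀
    regroup : (gap σ a b + k) + (gap σ b c + m) ≡ gap σ a c + (k + m)
    regroup = trans (interchange (gap σ a b) (gap σ b c) k m)
                    (cong (_+ (k + m)) (sym (gap-trans σ a b c)))

  tight-weaken : ∀ {σ a b k k′} → Tight σ a b k → k ≤ k′ → Tight σ a b k′
  tight-weaken {σ} {a} {b} (w , p , w≤) k≤k′ = w , p , ≤-trans w≤ (+-monoʳ-≤ (gap σ a b) k≤k′)

  tight-mirror : ∀ {σ a b k} → Tight σ a b k → Tight σ (op b) (op a) k
  tight-mirror {σ} {a} {b} {k} (w , p , w≤) =
    w , mirror p , subst (λ z → w ≤ z + k) (sym (gap-mirror σ a b)) w≤

  tight-unmirror : ∀ {σ a b k} → Tight σ (op b) (op a) k → Tight σ a b k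
  tight-unmirror {σ} {a} {b} {k} t =
    subst₂ (λ x y → Tight σ x y k) (op-involutive a) (op-involutive b) (tight-mirror t)

  loose : ∀ {σ a b k w} → Path g a b w → ¬ Tight σ a b k → gap σ a b + k < w
  loose {w = w} p not-tight = ≰⇒> λ w≤ → not-tight (w , p , w≤)

  wSP-upper : ∀ {σ a b k} → Tight σ a b k → W a b ≤∞ (gap σ a b + k)
  wSP-upper (w , p , w≤) = ≤∞-trans (W _ _) (shortest-below p) w≤

  ρ-upper : ∀ {σ a} → Tight σ a (op a) 1ℤ → ρ W a ≤∞ val σ (op a)
  ρ-upper {σ} {a} t =
    half∞-≤∞ (W a (op a)) (subst (λ z → W a (op a) ≤∞ (z + 1ℤ)) (gap-op σ a) (wSP-upper t))

  ρ-sum-upper : ∀ {σ u v} → Tight σ u (op u) 1ℤ → Tight σ (op v) v 1ℤ →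
                (ρ W u +∞ ρ W (op v)) ≤∞ gap σ u v
  ρ-sum-upper {σ} {u} {v} tu tv =
    subst (_ ≤∞_) (sym (gap-halves σ u v))
      (+∞-mono (ρ W u) (ρ W (op v)) (ρ-upper tu)
         (ρ-upper (subst (λ z → Tight σ (op v) z 1ℤ) (sym (op-involutive v)) tv)))

  χ : ∀ {P : Set} → Dec P → ℤ
  χ (yes _) = 1ℤ
  χ (no _)  = 0ℤ

  χ-cong : ∀ {P Q : Set} → (P → Q) → (Q → P) → (dp : Dec P) (dq : Dec Q) → χ dp ≡ χ dq
  χ-cong _ _ (yes _) (yes _) = refl
  χ-cong _ _ (no _)  (no _)  = refl
  χ-cong f _ (yes p) (no ¬q) = ⊥-elim (¬q (f p))
  χ-cong _ g (no ¬p) (yes q) = ⊥-elim (¬p (g q))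

  -- Shifting a feasible potential around a pivot p that has no 1-tight path -p -> p.
  -- (A vertex cannot both reach p and be reached from -p tightly, so δ ∈ {-1, 0, 1}.)
  module Pivot (σ : Assignment n) (fe : Feasible g σ) (p : Vertex n)
               (no-cycle : ¬ Tight σ (op p) p 1ℤ) where

    δ : Vertex n → ℤ
    δ a = χ (tight? σ a p 0ℤ) - χ (tight? σ (op p) a 0ℤ)

    one-sided : ∀ {a} → Tight σ a p 0ℤ → ¬ Tight σ (op p) a 0ℤ
    one-sided ap pa = no-cycle (tight-weaken (tight-trans pa ap) (+≤+ z≤n))

    lowered : ∀ {a b w Δ} → Path g a b w → Δ ≤ 0ℤ → gap σ a b + Δ ≤ w
    lowered {a} {b} {w} q Δ≤0 =
      ≤-trans (+-monoʳ-≤ (gap σ a b) Δ≤0) (subst (_≤ w) (sym (+-identityʳ _)) (path-bound fe q))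

    raised : ∀ {a b w k Δ} → Path g a b w → ¬ Tight σ a b k → Δ ≤ 1ℤ + k → gap σ a b + Δ ≤ w
    raised {a} {b} {w} {k} {Δ} q not-tight Δ≤ = begin
      gap σ a b + Δ        ≤⟨ +-monoʳ-≤ (gap σ a b) Δ≤ ⟩
      gap σ a b + (1ℤ + k) ≡⟨ shuffle (gap σ a b) k ⟩
      1ℤ + (gap σ a b + k) ≤⟨ i<j⇒suc[i]≤j (loose q not-tight) ⟩
      w                    ∎
      where
      open ≤-Reasoning
      shuffle : ∀ x k → x + (1ℤ + k) ≡ 1ℤ + (x + k)
      shuffle = solve-∀

    -- the shift moves gap σ a b by at most the slack of any path a -> b: either the
    -- four tightness facts contradict no-cycle, or gap moves down, or it moves up by 1
    -- (resp. 2) and the path cannot be 0-tight (resp. 1-tight)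
    shift-within : ∀ {a b w} → Path g a b w →
                   (to-p : Dec (Tight σ a p 0ℤ)) (from-p : Dec (Tight σ (op p) a 0ℤ))
                   (to-p′ : Dec (Tight σ b p 0ℤ)) (from-p′ : Dec (Tight σ (op p) b 0ℤ)) →
                   gap σ a b + ((χ to-p′ - χ from-p′) - (χ to-p - χ from-p)) ≤ w
    shift-within q (yes ap) (yes pa) _ _ = ⊥-elim (one-sided ap pa)
    shift-within q _ _ (yes bp) (yes pb) = ⊥-elim (one-sided bp pb)
    shift-within q (yes _) (no _) (yes _) (no _) = lowered q ≤-refl
    shift-within q (yes _) (no _) (no _)  (no _) = lowered q -≤+
    shift-within q (yes _) (no _) (no _)  (yes _) = lowered q -≤+
    shift-within q (no _)  (no _) (no _)  (no _) = lowered q ≤-refl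
    shift-within q (no _)  (no _) (no _)  (yes _) = lowered q -≤+
    shift-within q (no _)  (yes _) (no _) (yes _) = lowered q ≤-refl
    shift-within q (no ¬ap) (no _) (yes bp) (no _) =
      raised {k = 0ℤ} q (λ ab → ¬ap (tight-trans ab bp)) ≤-refl
    shift-within q (no _) (yes pa) (no _) (no ¬pb) =
      raised {k = 0ℤ} q (λ ab → ¬pb (tight-trans pa ab)) ≤-refl
    shift-within q (no _) (yes pa) (yes bp) (no _) =
      raised {k = 1ℤ} q (λ ab → no-cycle (tight-trans pa (tight-trans ab bp))) ≤-refl

    -- by mirror symmetry the shift is compatible with negation, so it comes from an
    -- assignment of the variables
    δ-op : ∀ a → δ (op a) ≡ - δ a
    δ-op a = begin
      χ (tight? σ (op a) p 0ℤ) - χ (tight? σ (op p) (op a) 0ℤ)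
        ≡⟨ cong₂ _-_ (χ-cong to-p⇒ ⇒to-p (tight? σ (op a) p 0ℤ) (tight? σ (op p) a 0ℤ))
                     (χ-cong tight-unmirror tight-mirror
                             (tight? σ (op p) (op a) 0ℤ) (tight? σ a p 0ℤ)) ⟩
      χ (tight? σ (op p) a 0ℤ) - χ (tight? σ a p 0ℤ)
        ≡⟨ flip (χ (tight? σ a p 0ℤ)) (χ (tight? σ (op p) a 0ℤ)) ⟩
      - δ a ∎
      where
      open ≡-Reasoning
      flip : ∀ x y → y - x ≡ - (x - y)
      flip = solve-∀
      to-p⇒ : Tight σ (op a) p 0ℤ → Tight σ (op p) a 0ℤ
      to-p⇒ t = subst (λ z → Tight σ (op p) z 0ℤ) (op-involutive a) (tight-mirror t)
      ⇒to-p : Tight σ (op p) a 0ℤ → Tight σ (op a) p 0ℤ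
      ⇒to-p t = subst (λ z → Tight σ (op a) z 0ℤ) (op-involutive p) (tight-mirror t)

    shifted : Assignment n
    shifted x = σ x + δ (x , true)

    val-shift : ∀ a → val shifted a ≡ val σ a + δ a
    val-shift (x , true)  = refl
    val-shift (x , false) =
      trans (neg-distrib-+ (σ x) (δ (x , true))) (cong (λ z → - σ x + z) (sym (δ-op (x , true))))

    gap-shift : ∀ a b → gap shifted a b ≡ gap σ a b + (δ b - δ a)
    gap-shift a b =
      trans (cong₂ _-_ (val-shift b) (val-shift a)) (interchange (val σ a) (val σ b) (δ a) (δ b))
      where
      interchange : ∀ x y dx dy → (y + dy) - (x + dx) ≡ (y - x) + (dy - dx)
      interchange = solve-∀

    shifted-feasible : Feasible g shifted
    shifted-feasible {u} {v} {d} e =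
      subst₂ _≤_ (sym (gap-shift u v)) (+-identityʳ d)
        (shift-within (e ∷ []) (tight? σ u p 0ℤ) (tight? σ (op p) u 0ℤ)
                               (tight? σ v p 0ℤ) (tight? σ (op p) v 0ℤ))

    δ-pivot : δ p ≡ 1ℤ
    δ-pivot with tight? σ p p 0ℤ | tight? σ (op p) p 0ℤ
    ... | yes _  | no _  = refl
    ... | no ¬pp | _     = ⊥-elim (¬pp (tight-refl σ p))
    ... | yes pp | yes t = ⊥-elim (one-sided pp t)

    δ-nonpos : ∀ a → ¬ Tight σ a p 0ℤ → δ a ≤ 0ℤ
    δ-nonpos a ¬t with tight? σ a p 0ℤ | tight? σ (op p) a 0ℤ
    ... | yes t | _     = ⊥-elim (¬t t)
    ... | no _  | yes _ = -≤+
    ... | no _  | no _  = ≤-refl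

  raise-toward : ∀ {σ} → Feasible g σ → ∀ u v → ¬ Tight σ (op v) v 1ℤ → ¬ Tight σ u v 0ℤ →
                 Σ (Assignment n) λ σ′ → Feasible g σ′ × gap σ u v < gap σ′ u v
  raise-toward {σ} fe u v no-cycle ¬uv = shifted , shifted-feasible , increase
    where
    open Pivot σ fe v no-cycle
    positive : 0ℤ < δ v - δ u
    positive = subst (λ z → 0ℤ < z - δ u) (sym δ-pivot)
                 (suc[i]≤j⇒i<j (+-monoʳ-≤ 1ℤ (neg-mono-≤ (δ-nonpos u ¬uv))))
    increase : gap σ u v < gap shifted u v
    increase = subst₂ _<_ (+-identityʳ (gap σ u v)) (sym (gap-shift u v))
                 (+-monoʳ-< (gap σ u v) positive)

  -- The mirror image, pivoting at p = -u.
  raise-from : ∀ {σ} → Feasible g σ → ∀ u v → ¬ Tight σ u (op u) 1ℤ → ¬ Tight σ u v 0ℤ →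
               Σ (Assignment n) λ σ′ → Feasible g σ′ × gap σ u v < gap σ′ u v
  raise-from {σ} fe u v no-cycle ¬uv
    with raise-toward fe (op v) (op u)
           (λ t → no-cycle (subst (λ z → Tight σ z (op u) 1ℤ) (op-involutive u) t))
           (λ t → ¬uv (tight-unmirror t))
  ... | σ′ , fe′ , gain = σ′ , fe′ , subst₂ _<_ (gap-mirror σ u v) (gap-mirror σ′ u v) gain

  raise : ∀ {σ} → Feasible g σ → ∀ u v → ¬ Tight σ u v 0ℤ →
          ¬ ((ρ W u +∞ ρ W (op v)) ≤∞ gap σ u v) →
          Σ (Assignment n) λ σ′ → Feasible g σ′ × gap σ u v < gap σ′ u v
  raise {σ} fe u v ¬uv ρ-above with tight? σ (op v) v 1ℤ | tight? σ u (op u) 1ℤ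
  ... | no ¬cv | _      = raise-toward fe u v ¬cv ¬uv
  ... | yes _  | no ¬cu = raise-from fe u v ¬cu ¬uv
  ... | yes cv | yes cu = ⊥-elim (ρ-above (ρ-sum-upper cu cv))

  raise-below : ∀ {σ u v e} → ¬ (W u v ≤∞ e) → ¬ ((ρ W u +∞ ρ W (op v)) ≤∞ e) →
                Feasible g σ → gap σ u v ≤ e →
                Σ (Assignment n) λ σ′ → Feasible g σ′ × gap σ u v < gap σ′ u v
  raise-below {σ} {u} {v} {e} far ρ-far fe gap≤e = raise fe u v not-tight ρ-not-below
    where
    not-tight : ¬ Tight σ u v 0ℤ
    not-tight t = far (≤∞-trans (W u v) (wSP-upper t) (subst (_≤ e) (sym (+-identityʳ _)) gap≤e))
    ρ-not-below : ¬ ((ρ W u +∞ ρ W (op v)) ≤∞ gap σ u v)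
    ρ-not-below r = ρ-far (≤∞-trans (ρ W u +∞ ρ W (op v)) r gap≤e)

  -- Completeness core: if neither wSP(u,v) ≤ e nor ρ(u) + ρ(-v) ≤ e, every feasible
  -- potential can be raised until gap u v exceeds e; k bounds the number of raises.
  escape : ∀ {u v e} → ¬ (W u v ≤∞ e) → ¬ ((ρ W u +∞ ρ W (op v)) ≤∞ e) →
           ∀ k {σ} → Feasible g σ → e < gap σ u v + + k →
           Σ (Assignment n) λ σ′ → Feasible g σ′ × e < gap σ′ u v
  escape far ρ-far zero {σ} fe e< = σ , fe , subst (_ <_) (+-identityʳ _) e<
  escape {u} {v} {e} far ρ-far (suc k) {σ} fe e< with gap σ u v ≤? e
  ... | no gap≰e = σ , fe , ≰⇒> gap≰e
  ... | yes gap≤e with raise-below far ρ-far fe gap≤e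
  ...   | σ′ , fe′ , gain = escape far ρ-far k fe′ (<-≤-trans e< budget)
    where
    shift-one : ∀ x y → x + (1ℤ + y) ≡ (1ℤ + x) + y
    shift-one = solve-∀
    budget : gap σ u v + + suc k ≤ gap σ′ u v + + k
    budget = ≤-trans (≤-reflexive (shift-one (gap σ u v) (+ k)))
                     (+-monoˡ-≤ (+ k) (i<j⇒suc[i]≤j gain))

theorem4 : ∀ {n : ℕ} (φ : System n) (c : UTVPI n)
             (wSP : Vertex n → Vertex n → ℤ∞) → IsWSPFun (G φ) wSP →
             Satisfiable φ →
             (φ ⊨ c) ⇔ (∀ u v e → edge u v e ∈ E c →
                          (wSP u v ≤∞ e) ⊎ ((ρ wSP u +∞ ρ wSP (op v)) ≤∞ e))
theorem4 φ c W W-spec (σ₀ , σ₀-sat) = mk⇔ complete sound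
  where
  open Potentials (G φ) (G-mirror φ) W W-spec

  feasible : ∀ {σ} → All.All (Sat σ) φ → Feasible (G φ) σ
  feasible {σ} = Equivalence.to (solution⇔feasible σ φ)

  sound : (∀ u v e → edge u v e ∈ E c → (W u v ≤∞ e) ⊎ ((ρ W u +∞ ρ W (op v)) ≤∞ e)) → φ ⊨ c
  sound cond σ sat = Equivalence.from (sat⇔feasible σ c) edge-ok
    where
    edge-ok : Feasible (E c) σ
    edge-ok {u} {v} {e} m with cond u v e m
    ... | inj₁ w≤e = ≼-≤∞ (W u v) (wSP-lower (feasible sat) u v) w≤e
    ... | inj₂ ρ≤e = ≼-≤∞ (ρ W u +∞ ρ W (op v)) (ρ-sum-lower (feasible sat) u v) ρ≤e

  complete : φ ⊨ c → ∀ u v e → edge u v e ∈ E c → (W u v ≤∞ e) ⊎ ((ρ W u +∞ ρ W (op v)) ≤∞ e)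
  complete φ⊨c u v e m with W u v ≤∞? e | (ρ W u +∞ ρ W (op v)) ≤∞? e
  ... | yes w≤e | _       = inj₁ w≤e
  ... | no _    | yes ρ≤e = inj₂ ρ≤e
  ... | no far  | no ρ-far
    with escape far ρ-far _ (feasible σ₀-sat) (below-budget e (gap σ₀ u v))
  ... | σ , fe , e<gap = ⊥-elim (<-irrefl refl (<-≤-trans e<gap violated))
    where
    violated : gap σ u v ≤ e
    violated = Equivalence.to (sat⇔feasible σ c)
                 (φ⊨c σ (Equivalence.from (solution⇔feasible σ φ) fe)) m
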